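{- For every integer $m\ge1$ and every term $w=w_1\otimes\cdots\otimes w_{m+1}$ of $P^m=(X\otimes Y+Y\otimes X)^m\in B^{\otimes(m+1)}$, there exists an integer $k\ge0$ such that $w$ begins with $k$ copies of $X$ followed by $Y$, and there exists an integer $\ell\ge0$ such that $w$ ends with $Y$ followed by $\ell$ copies of $X$.
   Context: Let $\mathcal M=\mathbb Z\langle y,n\rangle/(yn=ny=n,\ n^2=0,\ y^2=y)$. In the ring $\mathcal M\otimes\mathcal M$ (tensor over $\mathbb Z$, with $(a\otimes b)(c\otimes d)=ac\otimes bd$) put $X=y\otimes n+n\otimes y$, $Y=y\otimes y$, $Z=n\otimes n$, and let $B$ be the $\mathbb Z$-span of $X,Y,Z$: a commutative subring, free abelian with basis $X,Y,Z$, with $X^2=2Z$, $Y^2=Y$, $Z^2=0$, $XY=YX=X$, $XZ=ZX=0$, $YZ=ZY=Z$. For $r\ge1$, $B^{\otimes r}$ is free abelian with basis the words $w_1\otimes\cdots\otimes w_r$, $w_i\in\{X,Y,Z\}$; writing $u\in B^{\otimes r}$ uniquely as $\sum_w c_w w$, a term of $u$ is a word $w$ with $c_w\ne0$, and $c_w$ is its coefficient. The chaining product $B^{\otimes r}\times B^{\otimes s}\to B^{\otimes(r+s-1)}$ is the bilinear (associative) map $(a_1\otimes\cdots\otimes a_r)\cdot(b_1\otimes\cdots\otimes b_s)=a_1\otimes\cdots\otimes a_{r-1}\otimes(a_rb_1)\otimes b_2\otimes\cdots\otimes b_s$. Let $P=X\otimes Y+Y\otimes X\in B^{\otimes2}$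 and let $P^m\in B^{\otimes(m+1)}$ be its $m$-fold chaining product. -}

module Defs where

open import Data.Nat using (ℕ; zero; suc; _+_; NonZero)
open import Data.Integer using (ℤ; +_; _*_) renaming (_+_ to _+ℤ_)
open import Data.Product using (_×_; _,_)
open import Data.List using (List; []; _∷_; concatMap)
open import Data.Vec using (Vec; []; _∷_)
import Data.Vec.Properties as VP
open import Relation.Binary.PropositionalEquality using (_≡_; refl)
open import Relation.Binary.Definitions using (DecidableEquality)
open import Relation.Nullary using (yes; no)

data Gen : Set where
  X Y Z : Gen

_≟G_ : DecidableEquality Gen
X ≟G X = yes refl
X ≟G Y = no (λ ())
X ≟G Z = no (λ ())
Y ≟G X = no (λ ())
Y ≟G Y = yes refl
Y ≟G Z = no (λ ())
Z ≟G X = no (λ ())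
Z ≟G Y = no (λ ())
Z ≟G Z = yes refl

-- Multiplication table of B on basis elements: a * b = c · g.
-- X^2 = 2Z, Y^2 = Y, Z^2 = 0, XY = YX = X, XZ = ZX = 0, YZ = ZY = Z.
mulGen : Gen → Gen → ℤ × Gen
mulGen X X = (+ 2 , Z)
mulGen X Y = (+ 1 , X)
mulGen X Z = (+ 0 , Z)
mulGen Y X = (+ 1 , X)
mulGen Y Y = (+ 1 , Y)
mulGen Y Z = (+ 1 , Z)
mulGen Z X = (+ 0 , Z)
mulGen Z Y = (+ 1 , Z)
mulGen Z Z = (+ 0 , Z)

-- An element of B^{⊗r}: a formal ℤ-linear combination of words of length r
-- (a finite list of (coefficient, word) pairs; repeats are summed).
Tens : ℕ → Set
Tens r = List (ℤ × Vec Gen r)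

coeff : ∀ {r} → Tens r → Vec Gen r → ℤ
coeff [] w = + 0
coeff ((c , v) ∷ u) w with VP.≡-dec _≟G_ v w
... | yes _ = c +ℤ coeff u w
... | no _  = coeff u w

-- Chaining product of two words: a₁…a_r · b₁…b_s = a₁…a_{r-1}(a_r b₁)b₂…b_s
chainWord : ∀ {r s} → Vec Gen (suc r) → Vec Gen (suc s) → ℤ × Vec Gen (suc (r + s))
chainWord {zero} (a ∷ []) (b ∷ bs) with mulGen a b
... | (c , g) = (c , g ∷ bs)
chainWord {suc r} (a ∷ as) bs with chainWord as bs
... | (c , v) = (c , a ∷ v)

chain : ∀ {r s} → Tens (suc r) → Tens (suc s) → Tens (suc (r + s))
chain u v = concatMap (λ { (c , a) → concatMap (λ { (d , b) → step c d (chainWord a b) }) v }) u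
  where
  step : ∀ {n} → ℤ → ℤ → ℤ × Vec Gen n → List (ℤ × Vec Gen n)
  step c d (e , w) = (c * d * e , w) ∷ []

P : Tens 2
P = (+ 1 , X ∷ Y ∷ []) ∷ (+ 1 , Y ∷ X ∷ []) ∷ []

-- P^m ∈ B^{⊗(m+1)} for m ≥ 1 (P^{m+1} = P · P^m, by associativity).
Ppow : (m : ℕ) → {{NonZero m}} → Tens (suc m)
Ppow (suc zero) = P
Ppow (suc (suc k)) = chain P (Ppow (suc k))

{-# OPTIONS --safe #-}
module Submission where

-- Call a word admissible if it begins with Xᵏ Y and ends with Y Xˡ.  Induct on
-- m using P^(m+1) = P · P^m.  If a word b of P^m is admissible, its first
-- letter is X or Y, on which Y acts as the identity, so X ⊗ Y · b = X ⊗ b;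
-- and Y ⊗ X · b is Y ⊗ X ⊗ b′ when b = Y ⊗ b′ and 2 · Y ⊗ Z ⊗ b′ when
-- b = X ⊗ b′.  Each of these words is again admissible.

open import Defs
open import Data.Nat using (ℕ; zero; suc; NonZero) renaming (_+_ to _+ℕ_)
open import Data.Integer using (ℤ; +_; _*_)
open import Data.Integer.Properties using (+-identityˡ)
open import Data.Product using (_×_; _,_; ∃-syntax)
open import Data.Sum using (_⊎_; inj₁; inj₂)
open import Data.List using (List; []; _∷_; _++_; replicate)
open import Data.List.Relation.Unary.All using (All; []; _∷_)
open import Data.List.Relation.Unary.All.Properties using (concat⁺; gmap⁺)
open import Data.Vec using (Vec; _∷_; []; toList)
open import Data.Vec.Properties using (≡-dec)
open import Data.Empty using (⊥-elim)
open import Relation.Binary.PropositionalEquality using (_≡_; _≢_; refl; cong; trans)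
open import Relation.Nullary using (yes; no)

data StartsXsY : List Gen → Set where
  here  : ∀ {w} → StartsXsY (Y ∷ w)
  there : ∀ {w} → StartsXsY w → StartsXsY (X ∷ w)

data EndsYXs : List Gen → Set where
  here  : ∀ ℓ → EndsYXs (Y ∷ replicate ℓ X)
  there : ∀ {a w} → EndsYXs w → EndsYXs (a ∷ w)

StartsXsY⇒split : ∀ {w} → StartsXsY w → ∃[ k ] ∃[ rest ] w ≡ replicate k X ++ (Y ∷ rest)
StartsXsY⇒split (here {w}) = 0 , w , refl
StartsXsY⇒split (there s) with StartsXsY⇒split s
... | k , rest , eq = suc k , rest , cong (X ∷_) eq

EndsYXs⇒split : ∀ {w} → EndsYXs w → ∃[ ℓ ] ∃[ front ] w ≡ front ++ (Y ∷ replicate ℓ X)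
EndsYXs⇒split (here ℓ) = ℓ , [] , refl
EndsYXs⇒split (there {a} e) with EndsYXs⇒split e
... | ℓ , front , eq = ℓ , a ∷ front , cong (a ∷_) eq

EndsYXs-dropX : ∀ {w} → EndsYXs (X ∷ w) → EndsYXs w
EndsYXs-dropX (there e) = e

EndsYXs-insertX : ∀ {w} → EndsYXs (Y ∷ w) → EndsYXs (Y ∷ X ∷ w)
EndsYXs-insertX (here ℓ)  = here (suc ℓ)
EndsYXs-insertX (there e) = there (there e)

Admissible : ∀ {n} → Vec Gen n → Set
Admissible w = StartsXsY (toList w) × EndsYXs (toList w)

Supported : ∀ {n} → (Vec Gen n → Set) → Tens n → Set
Supported Q = All λ { (c , v) → c ≡ + 0 ⊎ Q v }

coeff≢0⇒supported : ∀ {n} {Q : Vec Gen n → Set} (u : Tens n) {w : Vec Gen n} →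
                    Supported Q u → coeff u w ≢ + 0 → Q w
coeff≢0⇒supported []              []       c≢0 = ⊥-elim (c≢0 refl)
coeff≢0⇒supported ((c , v) ∷ u) {w} (q ∷ qs) c≢0 with ≡-dec _≟G_ v w | q
... | yes refl | inj₂ qw    = qw
... | yes refl | inj₁ refl = coeff≢0⇒supported u qs λ eq → c≢0 (trans (+-identityˡ _) eq)
... | no _     | _         = coeff≢0⇒supported u qs c≢0

-- The summand of chain contributed by the word a, taken with coefficient 1,
-- and the pair (d , b).
_·ₜ_ : ∀ {r s} → Vec Gen (suc r) → ℤ × Vec Gen (suc s) → ℤ × Vec Gen (suc (r +ℕ s))
a ·ₜ (d , b) = let (e , w) = chainWord a b in + 1 * d * e , w

AdmissibleTerm : ∀ {n} → ℤ × Vec Gen n → Set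
AdmissibleTerm (c , w) = c ≡ + 0 ⊎ Admissible w

XY·-admissible : ∀ {s} (t : ℤ × Vec Gen (suc s)) → AdmissibleTerm t →
                 AdmissibleTerm ((X ∷ Y ∷ []) ·ₜ t)
XY·-admissible (_ , X ∷ _) (inj₂ (s , e)) = inj₂ (there s , there e)
XY·-admissible (_ , Y ∷ _) (inj₂ (s , e)) = inj₂ (there s , there e)
XY·-admissible (_ , Z ∷ _) (inj₂ (() , _))
XY·-admissible (_ , X ∷ _) (inj₁ refl)    = inj₁ refl
XY·-admissible (_ , Y ∷ _) (inj₁ refl)    = inj₁ refl
XY·-admissible (_ , Z ∷ _) (inj₁ refl)    = inj₁ refl

YX·-admissible : ∀ {s} (t : ℤ × Vec Gen (suc s)) → AdmissibleTerm t →
                 AdmissibleTerm ((Y ∷ X ∷ []) ·ₜ t)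
YX·-admissible (_ , X ∷ _) (inj₂ (_ , e)) = inj₂ (here , there (there (EndsYXs-dropX e)))
YX·-admissible (_ , Y ∷ _) (inj₂ (_ , e)) = inj₂ (here , EndsYXs-insertX e)
YX·-admissible (_ , Z ∷ _) (inj₂ (() , _))
YX·-admissible (_ , X ∷ _) (inj₁ refl)    = inj₁ refl
YX·-admissible (_ , Y ∷ _) (inj₁ refl)    = inj₁ refl
YX·-admissible (_ , Z ∷ _) (inj₁ refl)    = inj₁ refl

chainP-supported : ∀ {s} (u : Tens (suc s)) →
                   Supported Admissible u → Supported Admissible (chain P u)
chainP-supported u sup =
  concat⁺ ( concat⁺ (gmap⁺ (λ {t} a → XY·-admissible t a ∷ []) sup)
          ∷ concat⁺ (gmap⁺ (λ {t} a → YX·-admissible t a ∷ []) sup)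
          ∷ [])

Ppow-supported : (m : ℕ) → {{_ : NonZero m}} → Supported Admissible (Ppow m)
Ppow-supported (suc zero)    = inj₂ (there here , there (here 0)) ∷ inj₂ (here , here 1) ∷ []
Ppow-supported (suc (suc k)) = chainP-supported (Ppow (suc k)) (Ppow-supported (suc k))

lemma5p6 : (m : ℕ) → {{_ : NonZero m}} → (w : Vec Gen (suc m)) →
    coeff (Ppow m) w ≢ + 0 →
    (∃[ k ] ∃[ rest ] toList w ≡ replicate k X ++ (Y ∷ rest)) ×
    (∃[ ℓ ] ∃[ front ] toList w ≡ front ++ (Y ∷ replicate ℓ X))
lemma5p6 m w c≢0 with coeff≢0⇒supported (Ppow m) (Ppow-supported m) c≢0
... | starts , ends = StartsXsY⇒split starts , EndsYXs⇒split ends
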